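{- Let $P$ be a property of subsets of $\mathbb{N}$ such that (a) whenever $A,B\subseteq\mathbb{N}$, $P(A)$ holds and $A\leq_{fe}B$, then $P(B)$ holds; and (b) there exists an ultrafilter $\mathcal{V}$ on $\mathbb{N}$ all of whose members satisfy $P$. Then for every ultrafilter $\mathcal{U}$ on $\mathbb{N}$ such that $\mathcal{W}\leq_{fe}\mathcal{U}$ for every ultrafilter $\mathcal{W}$ on $\mathbb{N}$, and for every $A\in\mathcal{U}$, $P(A)$ holds.
   Context: $\mathbb{N}=\{0,1,2,\dots\}$. For $A,B\subseteq\mathbb{N}$, $A\leq_{fe}B$ means that for every finite $F\subseteq A$ there is $k\in\mathbb{N}$ with $F+k\subseteq B$. For ultrafilters, $\mathcal{U}\leq_{fe}\mathcal{V}$ means that for every $B\in\mathcal{V}$ there is $A\in\mathcal{U}$ with $A\leq_{fe}B$. -}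

module Defs where

open import Data.Nat using (ℕ; _+_)
open import Data.List using (List)
open import Data.List.Relation.Unary.All using (All)
open import Data.List.Membership.Propositional using (_∈_)
open import Data.Product using (_×_; Σ; ∃)
open import Data.Sum using (_⊎_)
open import Data.Empty using (⊥)
open import Data.Unit using (⊤)
open import Relation.Nullary using (¬_)
open import Level using (Level; suc; zero)

Subset : Set₁
Subset = ℕ → Set

_⊆_ : Subset → Subset → Set
A ⊆ B = ∀ n → A n → B n

_≤fe_ : Subset → Subset → Set
A ≤fe B = (F : List ℕ) → All A F → Σ ℕ λ k → All (λ x → B (x + k)) F

Family : Set₂
Family = Subset → Set₁

_∩_ : Subset → Subset → Subset
(A ∩ B) n = A n × B n

∁ : Subset → Subset
∁ A n = ¬ A n

record IsUltrafilter (U : Family) : Set₁ where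
  field
    whole    : U (λ _ → ⊤)
    proper   : ¬ U (λ _ → ⊥)
    upward   : ∀ A B → A ⊆ B → U A → U B
    meet     : ∀ A B → U A → U B → U (A ∩ B)
    ultra    : ∀ A → U A ⊎ U (∁ A)

_≤feU_ : Family → Family → Set₁
U ≤feU V = ∀ B → V B → Σ Subset λ A → U A × (A ≤fe B)

module Submission where

open import Defs
open import Data.Product using (Σ; _×_; _,_)

≤feU-upward-closed : (P : Subset → Set) →
    (∀ A B → P A → A ≤fe B → P B) →
    (V U : Family) → (∀ A → V A → P A) → V ≤feU U →
    ∀ A → U A → P A
≤feU-upward-closed P mono V U pV V≤U B UB with V≤U B UB
... | A , VA , A≤B = mono A B (pV A VA) A≤B

proposition30 : (P : Subset → Set) →
    (∀ A B → P A → A ≤fe B → P B) →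
    Σ Family (λ V → IsUltrafilter V × (∀ A → V A → P A)) →
    (U : Family) → IsUltrafilter U →
    (∀ (W : Family) → IsUltrafilter W → W ≤feU U) →
    ∀ A → U A → P A
proposition30 P mono (V , isV , pV) U _ maxU =
  ≤feU-upward-closed P mono V U pV (maxU V isV)
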